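{- Every threshold graph is edge simplicial and co-edge simplicial (i.e., its complement is edge simplicial). Moreover, the inclusion is proper: there exists a graph that is edge simplicial and co-edge simplicial but not threshold.
   Context: A graph is threshold if and only if it has no induced subgraph isomorphic to $2K_2$, $C_4$ or $P_4$ (equivalently, its vertex set can be partitioned into a stable set $I$ and a clique $K$ such that the vertices $u_1,\dots,u_k$ of $I$ can be ordered with $N(u_1)\subseteq N(u_2)\subseteq\dots\subseteq N(u_k)$). A clique $K$ is simplicial if $K=N[v]$ for some vertex $v$; a graph is edge simplicial if every edge lies in a simplicial clique. -}

module Defs where

open import Data.Nat using (ℕ)
open import Data.Fin using (Fin; _≟_)
open import Data.Bool using (Bool; true; false; not; if_then_else_)
open import Data.Product using (Σ; ∃; _×_; _,_)
open import Data.Empty using (⊥-elim)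
open import Data.Sum using (_⊎_)
open import Relation.Nullary using (¬_; does; yes; no)
open import Relation.Binary.PropositionalEquality using (_≡_; refl; _≢_; sym)

record Graph : Set where
  field
    n      : ℕ
    adj    : Fin n → Fin n → Bool
    adj-sym   : ∀ x y → adj x y ≡ adj y x
    adj-irrefl : ∀ x → adj x x ≡ false

open Graph public

Adj : (G : Graph) → Fin (n G) → Fin (n G) → Set
Adj G x y = adj G x y ≡ true

NAdj : (G : Graph) → Fin (n G) → Fin (n G) → Set
NAdj G x y = adj G x y ≡ false

coAdj : ∀ {m} → (Fin m → Fin m → Bool) → Fin m → Fin m → Bool
coAdj a x y = if does (x ≟ y) then false else not (a x y)

private
  coAdj-sym : ∀ {m} (a : Fin m → Fin m → Bool) → (∀ x y → a x y ≡ a y x) →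
              ∀ x y → coAdj a x y ≡ coAdj a y x
  coAdj-sym a s x y with x ≟ y | y ≟ x
  ... | yes _ | yes _ = refl
  ... | yes p | no q = ⊥-elim (q (sym p))
  ... | no q | yes p = ⊥-elim (q (sym p))
  ... | no _ | no _ rewrite s x y = refl

  coAdj-irrefl : ∀ {m} (a : Fin m → Fin m → Bool) → ∀ x → coAdj a x x ≡ false
  coAdj-irrefl a x with x ≟ x
  ... | yes _ = refl
  ... | no q = ⊥-elim (q refl)

complement : Graph → Graph
complement G = record
  { n = n G
  ; adj = coAdj (adj G)
  ; adj-sym = coAdj-sym (adj G) (adj-sym G)
  ; adj-irrefl = coAdj-irrefl (adj G)
  }

Distinct4 : ∀ {m} → Fin m → Fin m → Fin m → Fin m → Set
Distinct4 a b c d = a ≢ b × a ≢ c × a ≢ d × b ≢ c × b ≢ d × c ≢ d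

Induced2K2 : (G : Graph) → (a b c d : Fin (n G)) → Set
Induced2K2 G a b c d = Distinct4 a b c d ×
  Adj G a b × Adj G c d ×
  NAdj G a c × NAdj G a d × NAdj G b c × NAdj G b d

InducedC4 : (G : Graph) → (a b c d : Fin (n G)) → Set
InducedC4 G a b c d = Distinct4 a b c d ×
  Adj G a b × Adj G b c × Adj G c d × Adj G d a ×
  NAdj G a c × NAdj G b d

InducedP4 : (G : Graph) → (a b c d : Fin (n G)) → Set
InducedP4 G a b c d = Distinct4 a b c d ×
  Adj G a b × Adj G b c × Adj G c d ×
  NAdj G a c × NAdj G b d × NAdj G a d

Threshold : Graph → Set
Threshold G = ∀ a b c d →
  ¬ Induced2K2 G a b c d × ¬ InducedC4 G a b c d × ¬ InducedP4 G a b c d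

InClosedNbhd : (G : Graph) → Fin (n G) → Fin (n G) → Set
InClosedNbhd G v x = x ≡ v ⊎ Adj G v x

IsClique : (G : Graph) → (Fin (n G) → Set) → Set
IsClique G K = ∀ x y → K x → K y → x ≢ y → Adj G x y

SimplicialAt : (G : Graph) → Fin (n G) → Set
SimplicialAt G v = IsClique G (InClosedNbhd G v)

EdgeSimplicial : Graph → Set
EdgeSimplicial G = ∀ x y → Adj G x y →
  ∃ λ v → SimplicialAt G v × InClosedNbhd G v x × InClosedNbhd G v y

CoEdgeSimplicial : Graph → Set
CoEdgeSimplicial G = EdgeSimplicial (complement G)

module Submission where

open import Defs
open import Data.Product using (Σ; ∃; _×_)
open import Relation.Nullary using (¬_)

open import Data.Nat using (ℕ; suc)
open import Data.Bool using (Bool; true; false; not; _∨_)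
open import Data.Bool.Properties using (∨-comm; not-¬; ¬-not; not-injective) renaming (_≟_ to _≟ᵇ_)
open import Data.Fin using (Fin; toℕ; _≟_; #_)
open import Data.Fin.Properties using (all?; any?)
open import Data.Fin.Subset using (Subset; _∈_; _⊂_)
open import Data.Fin.Subset.Induction using (⊂-wellFounded)
open import Data.Vec.Base using (tabulate)
open import Data.Vec.Properties using (lookup∘tabulate; []=⇒lookup; lookup⇒[]=)
open import Data.Product using (∃₂; _,_; proj₁; proj₂)
open import Data.Sum using (_⊎_; inj₁; inj₂)
open import Data.Empty using (⊥; ⊥-elim)
open import Function using (_∘_)
open import Level using (Level)
open import Relation.Nullary using (Dec; yes; no; does)
open import Relation.Nullary.Decidable using (toWitness; dec-true; _⊎-dec_; _×-dec_; _→-dec_; ¬?)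
open import Relation.Unary using (Pred; Decidable)
open import Relation.Binary.PropositionalEquality using (_≡_; _≢_; refl; sym; trans)
open import Induction.WellFounded using (Acc; acc; WellFounded)
import Relation.Binary.Construct.On as On

-- The heart of the argument is that every graph with no induced C4 and no
-- induced P4 is edge simplicial.  In such a graph a common neighbour v of two
-- non-adjacent vertices a, b dominates a: N[a] ⊆ N[v], and the inclusion is
-- proper since b ∈ N[v] ∖ N[a].  Given an edge xy, start with the closed
-- neighbourhood N[x], which contains x and y.  If the current N[v] ∋ x, y is
-- not a clique, a non-adjacent pair p, q inside it produces a vertex w with
-- x, y ∈ N[w] ⊊ N[v]: either w = p, or w is whichever of x, y misses N[p].
-- Proper inclusion of subsets of a finite set is well founded, so this
-- descent stops at a simplicial clique N[v] containing the edge.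
-- A threshold graph is C4- and P4-free, and so is its complement, because an
-- induced C4 of the complement is an induced 2K2 of the graph and an induced
-- P4 of the complement is an induced P4 of the graph; this is the first half.
-- For properness, the bull graph is verified by decision procedures to be
-- edge simplicial and co-edge simplicial, and it contains an induced P4.

module _ (G : Graph) where

  adj-flip : ∀ {x y b} → adj G x y ≡ b → adj G y x ≡ b
  adj-flip {x} {y} xy = trans (adj-sym G y x) xy

  Adj-NAdj : ∀ {x y} → Adj G x y → NAdj G x y → ⊥
  Adj-NAdj xy x≁y = not-¬ xy x≁y

  Adj⇒≢ : ∀ {x y} → Adj G x y → x ≢ y
  Adj⇒≢ xy refl = Adj-NAdj xy (adj-irrefl G _)

  Adj-NAdj⇒≢ : ∀ {a u b} → Adj G a u → NAdj G a b → u ≢ b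
  Adj-NAdj⇒≢ au a≁b refl = Adj-NAdj au a≁b

  N? : ∀ v → Decidable (InClosedNbhd G v)
  N? v x = (x ≟ v) ⊎-dec (adj G v x ≟ᵇ true)

  N⇒Adj : ∀ {v z} → InClosedNbhd G v z → z ≢ v → Adj G v z
  N⇒Adj (inj₁ z≡v) z≢v = ⊥-elim (z≢v z≡v)
  N⇒Adj (inj₂ vz) _ = vz

  ∉N : ∀ {a b} → b ≢ a → NAdj G a b → ¬ InClosedNbhd G a b
  ∉N b≢a _ (inj₁ b≡a) = b≢a b≡a
  ∉N _ a≁b (inj₂ ab) = Adj-NAdj ab a≁b

module _ (G : Graph) where

  NonEdgeIn : (Fin (n G) → Set) → Fin (n G) → Fin (n G) → Set
  NonEdgeIn K p q = K p × K q × p ≢ q × NAdj G p q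

  nonEdgeIn? : ∀ {K} → Decidable K → ∀ p q → Dec (NonEdgeIn K p q)
  nonEdgeIn? K? p q = K? p ×-dec K? q ×-dec ¬? (p ≟ q) ×-dec (adj G p q ≟ᵇ false)

  clique-or-nonedge : ∀ {K} → Decidable K → IsClique G K ⊎ ∃₂ (NonEdgeIn K)
  clique-or-nonedge K? with any? (λ p → any? (nonEdgeIn? K? p))
  ... | yes nonedge = inj₂ nonedge
  ... | no none = inj₁ λ x y Kx Ky x≢y → ¬-not λ x≁y → none (x , y , Kx , Ky , x≢y , x≁y)

  clique? : ∀ {K} → Decidable K → Dec (IsClique G K)
  clique? K? with clique-or-nonedge K?
  ... | inj₁ clique = yes clique
  ... | inj₂ (p , q , Kp , Kq , p≢q , p≁q) = no λ clique → Adj-NAdj G (clique p q Kp Kq p≢q) p≁q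

  edgeSimplicial? : Dec (EdgeSimplicial G)
  edgeSimplicial? =
    all? λ x → all? λ y → (adj G x y ≟ᵇ true) →-dec
      any? λ v → clique? (N? G v) ×-dec (N? G v x ×-dec N? G v y)

-- Decidable predicates on Fin m as subsets, to use the well-foundedness of ⊂.

module _ {m : ℕ} {ℓ : Level} where

  toSubset : {P : Pred (Fin m) ℓ} → Decidable P → Subset m
  toSubset P? = tabulate (does ∘ P?)

  ∈-toSubset : {P : Pred (Fin m) ℓ} (P? : Decidable P) → ∀ {x} → P x → x ∈ toSubset P?
  ∈-toSubset P? {x} px = lookup⇒[]= x _ (trans (lookup∘tabulate (does ∘ P?) x) (dec-true (P? x) px))

  ∈-toSubset⁻ : {P : Pred (Fin m) ℓ} (P? : Decidable P) → ∀ {x} → x ∈ toSubset P? → P x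
  ∈-toSubset⁻ P? {x} x∈ with P? x | trans (sym (lookup∘tabulate (does ∘ P?) x)) ([]=⇒lookup x∈)
  ... | yes px | _ = px
  ... | no _ | ()

  ⊂-toSubset : {P Q : Pred (Fin m) ℓ} (P? : Decidable P) (Q? : Decidable Q) →
               (∀ x → P x → Q x) → ∀ {b} → Q b → ¬ P b → toSubset P? ⊂ toSubset Q?
  ⊂-toSubset P? Q? P⊆Q qb ¬pb =
    (λ {x} x∈P → ∈-toSubset Q? (P⊆Q x (∈-toSubset⁻ P? x∈P))) ,
    _ , ∈-toSubset Q? qb , ¬pb ∘ ∈-toSubset⁻ P?

C4P4Free : Graph → Set
C4P4Free G = ∀ a b c d → ¬ InducedC4 G a b c d × ¬ InducedP4 G a b c d

module C4P4FreeGraph (G : Graph) (free : C4P4Free G) where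

  V = Fin (n G)
  N = InClosedNbhd G

  -- A common neighbour v of non-adjacent a ≠ b dominates a: N[a] ⊆ N[v].
  -- A neighbour u of a outside N[v] would give the C4 a-u-b-v or the P4 u-a-v-b.
  nbhd-dominated : ∀ {v a b} → Adj G v a → Adj G v b → a ≢ b → NAdj G a b →
                   ∀ u → N a u → N v u
  nbhd-dominated va _ _ _ _ (inj₁ refl) = inj₂ va
  nbhd-dominated {v} {a} {b} va vb a≢b a≁b u (inj₂ au)
    with u ≟ v | adj G v u in vu | adj G u b in ub
  ... | yes u≡v | _ | _ = inj₁ u≡v
  ... | no _ | true | _ = inj₂ refl
  ... | no u≢v | false | true = ⊥-elim (proj₁ (free a u b v)
          ((Adj⇒≢ G au , a≢b , Adj⇒≢ G (adj-flip G va) , Adj-NAdj⇒≢ G au a≁b , u≢v , Adj⇒≢ G (adj-flip G vb)) ,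
           au , ub , adj-flip G vb , va , a≁b , adj-flip G vu))
  ... | no u≢v | false | false = ⊥-elim (proj₂ (free u a v b)
          ((Adj⇒≢ G (adj-flip G au) , u≢v , Adj-NAdj⇒≢ G au a≁b , Adj⇒≢ G (adj-flip G va) , a≢b , Adj⇒≢ G vb) ,
           adj-flip G au , adj-flip G va , vb , adj-flip G vu , a≁b , ub))

  _≺_ : V → V → Set
  w ≺ v = toSubset (N? G w) ⊂ toSubset (N? G v)

  ≺-wellFounded : WellFounded _≺_
  ≺-wellFounded = On.wellFounded (toSubset ∘ N? G) ⊂-wellFounded

  -- The domination above is proper: b ∈ N[v] ∖ N[a].
  shrink : ∀ {v a b} → Adj G v a → Adj G v b → a ≢ b → NAdj G a b → a ≺ v
  shrink va vb a≢b a≁b =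
    ⊂-toSubset (N? G _) (N? G _) (nbhd-dominated va vb a≢b a≁b) (inj₂ vb) (∉N G (a≢b ∘ sym) a≁b)

  escape : ∀ {v p z} → Adj G v p → N v z → ¬ N p z → z ≺ v
  escape vp z∈Nv z∉Np = shrink vz vp (λ z≡p → z∉Np (inj₁ z≡p)) (¬-not λ zp → z∉Np (inj₂ (adj-flip G zp)))
    where
    vz = N⇒Adj G z∈Nv λ { refl → z∉Np (inj₂ (adj-flip G vp)) }

  nonedge-end : ∀ {v p q} → N v p → N v q → p ≢ q → NAdj G p q → Adj G v p
  nonedge-end (inj₂ vp) _ _ _ = vp
  nonedge-end (inj₁ refl) (inj₁ refl) p≢q _ = ⊥-elim (p≢q refl)
  nonedge-end (inj₁ refl) (inj₂ vq) _ p≁q = ⊥-elim (Adj-NAdj G vq p≁q)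

  refine : ∀ {x y v p q} → Adj G x y → N v x → N v y → NonEdgeIn G (N v) p q →
           Σ V λ w → w ≺ v × N w x × N w y
  refine {x} {y} {p = p} xy x∈ y∈ (p∈ , q∈ , p≢q , p≁q) with N? G p x | N? G p y
  ... | yes px | yes py = p , shrink vp vq p≢q p≁q , px , py
    where
    vp = nonedge-end p∈ q∈ p≢q p≁q
    vq = nonedge-end q∈ p∈ (p≢q ∘ sym) (adj-flip G p≁q)
  ... | no x∉Np | _ = x , escape (nonedge-end p∈ q∈ p≢q p≁q) x∈ x∉Np , inj₁ refl , inj₂ xy
  ... | yes _ | no y∉Np = y , escape (nonedge-end p∈ q∈ p≢q p≁q) y∈ y∉Np , inj₂ (adj-flip G xy) , inj₁ refl

  descend : ∀ {x y} → Adj G x y → ∀ v → Acc _≺_ v → N v x → N v y →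
            ∃ λ w → SimplicialAt G w × N w x × N w y
  descend xy v (acc smaller) x∈ y∈ with clique-or-nonedge G (N? G v)
  ... | inj₁ clique = v , clique , x∈ , y∈
  ... | inj₂ (_ , _ , nonedge) with refine xy x∈ y∈ nonedge
  ... | w , w≺v , x∈′ , y∈′ = descend xy w (smaller w≺v) x∈′ y∈′

  edgeSimplicial : EdgeSimplicial G
  edgeSimplicial x y xy = descend xy x (≺-wellFounded x) (inj₁ refl) (inj₂ xy)

module _ (G : Graph) where

  private
    Gᶜ = complement G

  complement-adj : ∀ {x y} → x ≢ y → adj Gᶜ x y ≡ not (adj G x y)
  complement-adj {x} {y} x≢y with x ≟ y
  ... | yes x≡y = ⊥-elim (x≢y x≡y)
  ... | no _ = refl

  Adjᶜ⇒NAdj : ∀ {x y} → x ≢ y → Adj Gᶜ x y → NAdj G x y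
  Adjᶜ⇒NAdj x≢y xy = not-injective (trans (sym (complement-adj x≢y)) xy)

  NAdjᶜ⇒Adj : ∀ {x y} → x ≢ y → NAdj Gᶜ x y → Adj G x y
  NAdjᶜ⇒Adj x≢y x≁y = not-injective (trans (sym (complement-adj x≢y)) x≁y)

  C4ᶜ⇒2K2 : ∀ {a b c d} → InducedC4 Gᶜ a b c d → Induced2K2 G a c b d
  C4ᶜ⇒2K2 ((a≢b , a≢c , a≢d , b≢c , b≢d , c≢d) , ab , bc , cd , da , a≁c , b≁d) =
    (a≢c , a≢b , a≢d , b≢c ∘ sym , c≢d , b≢d) ,
    NAdjᶜ⇒Adj a≢c a≁c , NAdjᶜ⇒Adj b≢d b≁d ,
    Adjᶜ⇒NAdj a≢b ab , adj-flip G (Adjᶜ⇒NAdj (a≢d ∘ sym) da) ,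
    adj-flip G (Adjᶜ⇒NAdj b≢c bc) , Adjᶜ⇒NAdj c≢d cd

  P4ᶜ⇒P4 : ∀ {a b c d} → InducedP4 Gᶜ a b c d → InducedP4 G b d a c
  P4ᶜ⇒P4 ((a≢b , a≢c , a≢d , b≢c , b≢d , c≢d) , ab , bc , cd , a≁c , b≁d , a≁d) =
    (b≢d , a≢b ∘ sym , b≢c , a≢d ∘ sym , c≢d ∘ sym , a≢c) ,
    NAdjᶜ⇒Adj b≢d b≁d , adj-flip G (NAdjᶜ⇒Adj a≢d a≁d) , NAdjᶜ⇒Adj a≢c a≁c ,
    adj-flip G (Adjᶜ⇒NAdj a≢b ab) , adj-flip G (Adjᶜ⇒NAdj c≢d cd) , Adjᶜ⇒NAdj b≢c bc

  threshold⇒C4P4Free : Threshold G → C4P4Free G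
  threshold⇒C4P4Free t a b c d = proj₁ (proj₂ (t a b c d)) , proj₂ (proj₂ (t a b c d))

  -- The third forbidden subgraph, 2K2, is the complement of C4; P4 is self-complementary.
  threshold⇒complement-C4P4Free : Threshold G → C4P4Free Gᶜ
  threshold⇒complement-C4P4Free t a b c d =
    (λ c4 → proj₁ (t a c b d) (C4ᶜ⇒2K2 c4)) ,
    (λ p4 → proj₂ (proj₂ (t b d a c)) (P4ᶜ⇒P4 p4))

-- Each edge is listed once, with its smaller end first; bullAdj symmetrises.
bullEdge : ℕ → ℕ → Bool
bullEdge 0 1 = true
bullEdge 1 2 = true
bullEdge 1 4 = true
bullEdge 2 4 = true
bullEdge 2 3 = true
bullEdge _ _ = false

bullEdge-irrefl : ∀ k → bullEdge k k ≡ false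
bullEdge-irrefl 0 = refl
bullEdge-irrefl 1 = refl
bullEdge-irrefl 2 = refl
bullEdge-irrefl (suc (suc (suc _))) = refl

bullAdj : Fin 5 → Fin 5 → Bool
bullAdj x y = bullEdge (toℕ x) (toℕ y) ∨ bullEdge (toℕ y) (toℕ x)

bullAdj-irrefl : ∀ x → bullAdj x x ≡ false
bullAdj-irrefl x rewrite bullEdge-irrefl (toℕ x) = refl

bull : Graph
bull = record
  { n = 5
  ; adj = bullAdj
  ; adj-sym = λ x y → ∨-comm (bullEdge (toℕ x) (toℕ y)) _
  ; adj-irrefl = bullAdj-irrefl
  }

bull-edgeSimplicial : EdgeSimplicial bull
bull-edgeSimplicial = toWitness {a? = edgeSimplicial? bull} _

bull-coEdgeSimplicial : CoEdgeSimplicial bull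
bull-coEdgeSimplicial = toWitness {a? = edgeSimplicial? (complement bull)} _

bull-notThreshold : ¬ Threshold bull
bull-notThreshold threshold = proj₂ (proj₂ (threshold (# 0) (# 1) (# 2) (# 3)))
  (((λ ()) , (λ ()) , (λ ()) , (λ ()) , (λ ()) , (λ ())) , refl , refl , refl , refl , refl , refl)

corollary33 : ((G : Graph) → Threshold G → EdgeSimplicial G × CoEdgeSimplicial G)
    × (∃ λ (G : Graph) → EdgeSimplicial G × CoEdgeSimplicial G × ¬ Threshold G)
corollary33 =
  (λ G t → C4P4FreeGraph.edgeSimplicial G (threshold⇒C4P4Free G t) ,
           C4P4FreeGraph.edgeSimplicial (complement G) (threshold⇒complement-C4P4Free G t)) ,
  (bull , bull-edgeSimplicial , bull-coEdgeSimplicial , bull-notThreshold)
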